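{- Let $n$ be a positive integer and $1\le k\le \lfloor\frac{n+1}{2}\rfloor-2$. Then for all integers $m$, $$w_{n,k+2,m}=a(n,k)w_{n,k+1,m-1}+b(n,k)w_{n,k+1,m}-c(n,k)w_{n,k,m},$$ where $a(n,k)=\frac{(n-k)(n-2k-2)(n-2k-3)}{(k+1)(k+2)(n-k-2)}$, $b(n,k)=\frac{2(n-k)(n-k-1)(n-2k-2)}{(k+2)(n-k-2)(n-2k-1)}$, $c(n,k)=\frac{(n-k+1)(n-k)^{2}(n-2k-3)}{(k+1)(k+2)(n-k-2)(n-2k-1)}$.
   Context: For integers $n,k,m$ (with $k\ge1$) define $w_{n,k,m}=\frac{1}{k}\binom{n}{k-1}\binom{n-k-1}{m-1}\binom{k}{m}$ if $0<m\le k$ and $k+m\le n$; $w_{n,k,m}=1$ if $m=0$ and $n=k$; and $w_{n,k,m}=0$ otherwise. -}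

module Defs where

open import Data.Nat as ℕ using (ℕ; zero; suc; _∸_; _≤?_; _≟_)
open import Data.Nat.Combinatorics using (_C_)
open import Data.Integer as ℤ using (ℤ; +_; -[1+_])
open import Data.Rational as ℚ using (ℚ; 0ℚ; 1ℚ)
open import Data.Bool using (if_then_else_)
open import Relation.Nullary.Decidable using (⌊_⌋; _×-dec_)

ℕtoℚ : ℕ → ℚ
ℕtoℚ p = (+ p) ℚ./ 1

-- p / d as a rational; the denominator 0 case is a dummy convention
-- (never used: all denominators in the statement are positive).
frac : ℕ → ℕ → ℚ
frac p zero    = 0ℚ
frac p (suc d) = (+ p) ℚ./ suc d

w : ℕ → ℕ → ℤ → ℚ
w n k -[1+ _ ]    = 0ℚ
w n k (+ zero)    = if ⌊ n ≟ k ⌋ then 1ℚ else 0ℚ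
w n k (+ (suc m')) =
  if ⌊ (suc m' ≤? k) ×-dec (k ℕ.+ suc m' ≤? n) ⌋
  then frac 1 k ℚ.* ℕtoℚ ((n C (k ∸ 1)) ℕ.* ((n ∸ k ∸ 1) C m') ℕ.* (k C suc m'))
  else 0ℚ

a : ℕ → ℕ → ℚ
a n k = frac ((n ∸ k) ℕ.* (n ∸ 2 ℕ.* k ∸ 2) ℕ.* (n ∸ 2 ℕ.* k ∸ 3))
             ((k ℕ.+ 1) ℕ.* (k ℕ.+ 2) ℕ.* (n ∸ k ∸ 2))

b : ℕ → ℕ → ℚ
b n k = frac (2 ℕ.* (n ∸ k) ℕ.* (n ∸ k ∸ 1) ℕ.* (n ∸ 2 ℕ.* k ∸ 2))
             ((k ℕ.+ 2) ℕ.* (n ∸ k ∸ 2) ℕ.* (n ∸ 2 ℕ.* k ∸ 1))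

c : ℕ → ℕ → ℚ
c n k = frac ((n ∸ k ℕ.+ 1) ℕ.* (n ∸ k) ℕ.* (n ∸ k) ℕ.* (n ∸ 2 ℕ.* k ∸ 3))
             ((k ℕ.+ 1) ℕ.* (k ℕ.+ 2) ℕ.* (n ∸ k ∸ 2) ℕ.* (n ∸ 2 ℕ.* k ∸ 1))

{-# OPTIONS --safe #-}
module Submission where

-- For m ≥ 1 the product (1/K) C(n,K-1) C(n-K-1,m-1) C(K,m) already vanishes when the
-- side conditions of w fail, so only m ≤ 0 needs separate (trivial) treatment.  With
-- n = 2k+3+t, absorption and the index-shifting forms of Pascal's rule make each of the
-- four values of w in the recurrence a polynomial multiple, divided by a positive
-- polynomial, of the single product B = C(n,k) C(n-k-1,m-1) C(k+2,m).  Over ℤ these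
-- proportions hold for all indices (a coefficient turns negative only where the binomial
-- it multiplies is zero), so clearing denominators turns the recurrence into the
-- polynomial identity recurrence-polynomial, of degree six in k, t and m.

open import Defs
open import Data.Nat as ℕ using (ℕ; zero; suc; _+_; _*_; _∸_; _≤_; s≤s; z≤n; ⌊_/2⌋)
open import Data.Nat.Properties
  using (*-zeroʳ; +-identityʳ; *-identityˡ; *-identityʳ; *-distribˡ-+; +-comm; +-cancelʳ-≡; +-cancelˡ-<;
         +-suc; n<1+n; _≤?_; _≟_; m+n∸m≡n; ≰⇒>; m+1+n≢m; ≤-pred; ≤-trans; +-mono-≤; m≤o∸n⇒m+n≤o;
         m≤n⇒∃[o]m+o≡n; ⌊n/2⌋≤⌈n/2⌉; ⌊n/2⌋+⌈n/2⌉≡n)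
open import Data.Nat.Combinatorics using (_C_; nC1≡n; nCk+nC[k+1]≡[n+1]C[k+1]; k>n⇒nCk≡0)
import Data.Nat.Tactic.RingSolver as ℕ-Ring
open import Data.Integer as ℤ using (ℤ; +_; -[1+_])
import Data.Integer.Properties as ℤP
import Data.Integer.Tactic.RingSolver as ℤ-Ring
open import Data.Rational as ℚ using (ℚ; 0ℚ; fromℚᵘ)
import Data.Rational.Properties as ℚP
open import Data.Rational.Unnormalised as ℚᵘ using (mkℚᵘ; *≡*)
import Data.Rational.Unnormalised.Properties as ℚᵘP
open import Algebra.Bundles using (CommutativeSemigroup)
open import Algebra.Properties.Group ℚP.+-0-group using (quasigroup)
open import Algebra.Properties.Quasigroup quasigroup using (x≈z//y)
open import Data.Bool using (if_then_else_)
open import Data.Empty using (⊥-elim)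
open import Data.Product using (_,_)
open import Relation.Nullary using (Dec; yes; no; ¬_)
open import Relation.Nullary.Decidable using (_×-dec_; ⌊_⌋)
open import Relation.Binary.PropositionalEquality
  using (_≡_; refl; sym; trans; cong; cong₂; subst; subst₂; module ≡-Reasoning)

-- Wrapping the equation in a
-- record keeps l, p, x and y visible to unification, which an equation between
-- integer products (reduced eagerly by the type checker) does not.
module Proportion {c ℓ} (S : CommutativeSemigroup c ℓ) where
  open CommutativeSemigroup S
  open import Algebra.Properties.CommutativeSemigroup S using (interchange; x∙yz≈y∙xz)
  open import Relation.Binary.Reasoning.Setoid setoid

  record Proportional (l p x y : Carrier) : Set ℓ where
    constructor proportional
    field equation : l ∙ x ≈ p ∙ y

  open Proportional public

  proportional-trans : ∀ {l₁ p₁ l₂ p₂ x y z} → Proportional l₁ p₁ x y → Proportional l₂ p₂ y z →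
                       Proportional (l₂ ∙ l₁) (p₁ ∙ p₂) x z
  proportional-trans {l₁} {p₁} {l₂} {p₂} {x} {y} {z} (proportional e₁) (proportional e₂) =
    proportional (begin
      (l₂ ∙ l₁) ∙ x  ≈⟨ assoc l₂ l₁ x ⟩
      l₂ ∙ (l₁ ∙ x)  ≈⟨ ∙-congˡ e₁ ⟩
      l₂ ∙ (p₁ ∙ y)  ≈⟨ x∙yz≈y∙xz l₂ p₁ y ⟩
      p₁ ∙ (l₂ ∙ y)  ≈⟨ ∙-congˡ e₂ ⟩
      p₁ ∙ (p₂ ∙ z)  ≈⟨ assoc p₁ p₂ z ⟨
      (p₁ ∙ p₂) ∙ z  ∎)

  proportional-∙ : ∀ {l₁ p₁ l₂ p₂ x₁ y₁ x₂ y₂} →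
                   Proportional l₁ p₁ x₁ y₁ → Proportional l₂ p₂ x₂ y₂ →
                   Proportional (l₁ ∙ l₂) (p₁ ∙ p₂) (x₁ ∙ x₂) (y₁ ∙ y₂)
  proportional-∙ {l₁} {p₁} {l₂} {p₂} {x₁} {y₁} {x₂} {y₂} (proportional e₁) (proportional e₂) =
    proportional (begin
      (l₁ ∙ l₂) ∙ (x₁ ∙ x₂)  ≈⟨ interchange l₁ l₂ x₁ x₂ ⟩
      (l₁ ∙ x₁) ∙ (l₂ ∙ x₂)  ≈⟨ ∙-cong e₁ e₂ ⟩
      (p₁ ∙ y₁) ∙ (p₂ ∙ y₂)  ≈⟨ interchange p₁ y₁ p₂ y₂ ⟩
      (p₁ ∙ p₂) ∙ (y₁ ∙ y₂)  ∎)

  proportional-∙ʳ : ∀ {l p x y} z → Proportional l p x y → Proportional l p (x ∙ z) (y ∙ z)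
  proportional-∙ʳ {l} {p} {x} {y} z (proportional e) = proportional (begin
    l ∙ (x ∙ z)  ≈⟨ assoc l x z ⟨
    (l ∙ x) ∙ z  ≈⟨ ∙-congʳ e ⟩
    (p ∙ y) ∙ z  ≈⟨ assoc p y z ⟩
    p ∙ (y ∙ z)  ∎)

  proportional-∙ˡ : ∀ {l p x y} z → Proportional l p x y → Proportional l p (z ∙ x) (z ∙ y)
  proportional-∙ˡ {l} {p} {x} {y} z (proportional e) = proportional (begin
    l ∙ (z ∙ x)  ≈⟨ x∙yz≈y∙xz l z x ⟩
    z ∙ (l ∙ x)  ≈⟨ ∙-congˡ e ⟩
    z ∙ (p ∙ y)  ≈⟨ x∙yz≈y∙xz z p y ⟩
    p ∙ (z ∙ y)  ∎)

open ≡-Reasoning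

[1+k]*[1+n]C[1+k]≡[1+n]*nCk : ∀ n k → suc k * (suc n C suc k) ≡ suc n * (n C k)
[1+k]*[1+n]C[1+k]≡[1+n]*nCk n zero =
  trans (+-identityʳ _) (trans (nC1≡n (suc n)) (sym (*-identityʳ (suc n))))
[1+k]*[1+n]C[1+k]≡[1+n]*nCk zero (suc k) = *-zeroʳ (suc (suc k))
[1+k]*[1+n]C[1+k]≡[1+n]*nCk (suc n) (suc k) = begin
  suc (suc k) * (suc (suc n) C suc (suc k))
    ≡⟨ cong (suc (suc k) *_) (sym (nCk+nC[k+1]≡[n+1]C[k+1] (suc n) (suc k))) ⟩
  suc (suc k) * (suc n C suc k + suc n C suc (suc k))
    ≡⟨ regroup (suc k) (suc n C suc k) (suc n C suc (suc k)) ⟩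
  suc k * (suc n C suc k) + suc (suc k) * (suc n C suc (suc k)) + suc n C suc k
    ≡⟨ cong₂ (λ x y → x + y + suc n C suc k)
         ([1+k]*[1+n]C[1+k]≡[1+n]*nCk n k) ([1+k]*[1+n]C[1+k]≡[1+n]*nCk n (suc k)) ⟩
  suc n * (n C k) + suc n * (n C suc k) + suc n C suc k
    ≡⟨ cong (_+ suc n C suc k) (sym (*-distribˡ-+ (suc n) (n C k) (n C suc k))) ⟩
  suc n * (n C k + n C suc k) + suc n C suc k
    ≡⟨ cong (λ x → suc n * x + suc n C suc k) (nCk+nC[k+1]≡[n+1]C[k+1] n k) ⟩
  suc n * (suc n C suc k) + suc n C suc k
    ≡⟨ +-comm (suc n * (suc n C suc k)) _ ⟩
  suc (suc n) * (suc n C suc k) ∎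
  where
  regroup : ∀ k x y → suc k * (x + y) ≡ k * x + suc k * y + x
  regroup = ℕ-Ring.solve-∀

[1+n]*nCk+k*[1+n]Ck≡[1+n]*[1+n]Ck : ∀ n k → suc n * (n C k) + k * (suc n C k) ≡ suc n * (suc n C k)
[1+n]*nCk+k*[1+n]Ck≡[1+n]*[1+n]Ck n zero = +-identityʳ _
[1+n]*nCk+k*[1+n]Ck≡[1+n]*[1+n]Ck n (suc k) = begin
  suc n * (n C suc k) + suc k * (suc n C suc k)
    ≡⟨ cong (λ x → suc n * (n C suc k) + x) ([1+k]*[1+n]C[1+k]≡[1+n]*nCk n k) ⟩
  suc n * (n C suc k) + suc n * (n C k)
    ≡⟨ sym (*-distribˡ-+ (suc n) (n C suc k) (n C k)) ⟩
  suc n * (n C suc k + n C k)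
    ≡⟨ cong (suc n *_) (trans (+-comm (n C suc k) (n C k)) (nCk+nC[k+1]≡[n+1]C[k+1] n k)) ⟩
  suc n * (suc n C suc k) ∎

[1+k]*[k+d]C[1+k]≡d*[k+d]Ck : ∀ k d → suc k * ((k + d) C suc k) ≡ d * ((k + d) C k)
[1+k]*[k+d]C[1+k]≡d*[k+d]Ck k zero rewrite +-identityʳ k | k>n⇒nCk≡0 (n<1+n k) = *-zeroʳ (suc k)
[1+k]*[k+d]C[1+k]≡d*[k+d]Ck k (suc d) rewrite +-suc k d =
  trans ([1+k]*[1+n]C[1+k]≡[1+n]*nCk (k + d) k)
        (+-cancelʳ-≡ (k * (suc (k + d) C k)) _ _ (begin
          suc (k + d) * ((k + d) C k) + k * (suc (k + d) C k)
            ≡⟨ [1+n]*nCk+k*[1+n]Ck≡[1+n]*[1+n]Ck (k + d) k ⟩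
          suc (k + d) * (suc (k + d) C k)
            ≡⟨ split k d (suc (k + d) C k) ⟩
          suc d * (suc (k + d) C k) + k * (suc (k + d) C k) ∎))
  where
  split : ∀ k d y → suc (k + d) * y ≡ suc d * y + k * y
  split = ℕ-Ring.solve-∀

open Proportion ℤP.*-commutativeSemigroup

proportional-rescale : ∀ {l p x y M r} .{{_ : ℤ.NonZero l}} →
                       Proportional l p x y → Proportional p l M r → M ℤ.* x ≡ r ℤ.* y
proportional-rescale {l} {p} {x} {y} {M} {r} (proportional e₁) (proportional e₂) =
  ℤP.*-cancelˡ-≡ l (M ℤ.* x) (r ℤ.* y) (begin
    l ℤ.* (M ℤ.* x)  ≡⟨ x∙yz≈y∙xz l M x ⟩
    M ℤ.* (l ℤ.* x)  ≡⟨ cong (M ℤ.*_) e₁ ⟩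
    M ℤ.* (p ℤ.* y)  ≡⟨ ℤP.*-assoc M p y ⟨
    (M ℤ.* p) ℤ.* y  ≡⟨ cong (ℤ._* y) (trans (ℤP.*-comm M p) e₂) ⟩
    (l ℤ.* r) ℤ.* y  ≡⟨ ℤP.*-assoc l r y ⟩
    l ℤ.* (r ℤ.* y)  ∎)
  where open import Algebra.Properties.CommutativeSemigroup ℤP.*-commutativeSemigroup using (x∙yz≈y∙xz)

pos-*-cong : ∀ m x n y → m * x ≡ n * y → + m ℤ.* + x ≡ + n ℤ.* + y
pos-*-cong m x n y eq = trans (sym (ℤP.pos-* m x)) (trans (cong +_ eq) (ℤP.pos-* n y))

infix 8 ⟦_C_⟧
⟦_C_⟧ : ℕ → ℕ → ℤ
⟦ n C k ⟧ = + (n C k)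

absorption : ∀ n k → Proportional (+ suc n) (+ suc k) ⟦ n C k ⟧ ⟦ suc n C suc k ⟧
absorption n k =
  proportional (sym (pos-*-cong (suc k) (suc n C suc k) (suc n) (n C k) ([1+k]*[1+n]C[1+k]≡[1+n]*nCk n k)))

top-step : ∀ n k → Proportional (+ suc n) (+ suc n ℤ.- + k) ⟦ n C k ⟧ ⟦ suc n C k ⟧
top-step n k = proportional (begin
  + suc n ℤ.* ⟦ n C k ⟧
    ≡⟨ isolate (+ suc n) ⟦ n C k ⟧ (+ k) ⟦ suc n C k ⟧ ⟩
  (+ suc n ℤ.* ⟦ n C k ⟧ ℤ.+ + k ℤ.* ⟦ suc n C k ⟧) ℤ.- + k ℤ.* ⟦ suc n C k ⟧
    ≡⟨ cong (ℤ._- + k ℤ.* ⟦ suc n C k ⟧) cast ⟩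
  + suc n ℤ.* ⟦ suc n C k ⟧ ℤ.- + k ℤ.* ⟦ suc n C k ⟧
    ≡⟨ factor (+ suc n) (+ k) ⟦ suc n C k ⟧ ⟩
  (+ suc n ℤ.- + k) ℤ.* ⟦ suc n C k ⟧ ∎)
  where
  isolate : ∀ x a y b → x ℤ.* a ≡ (x ℤ.* a ℤ.+ y ℤ.* b) ℤ.- y ℤ.* b
  isolate = ℤ-Ring.solve-∀
  factor : ∀ x y b → x ℤ.* b ℤ.- y ℤ.* b ≡ (x ℤ.- y) ℤ.* b
  factor = ℤ-Ring.solve-∀
  cast : + suc n ℤ.* ⟦ n C k ⟧ ℤ.+ + k ℤ.* ⟦ suc n C k ⟧ ≡ + suc n ℤ.* ⟦ suc n C k ⟧
  cast = begin
    + suc n ℤ.* ⟦ n C k ⟧ ℤ.+ + k ℤ.* ⟦ suc n C k ⟧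
      ≡⟨ cong₂ ℤ._+_ (ℤP.pos-* (suc n) (n C k)) (ℤP.pos-* k (suc n C k)) ⟨
    + (suc n * (n C k)) ℤ.+ + (k * (suc n C k))
      ≡⟨ ℤP.pos-+ (suc n * (n C k)) (k * (suc n C k)) ⟨
    + (suc n * (n C k) + k * (suc n C k))
      ≡⟨ cong +_ ([1+n]*nCk+k*[1+n]Ck≡[1+n]*[1+n]Ck n k) ⟩
    + (suc n * (suc n C k))
      ≡⟨ ℤP.pos-* (suc n) (suc n C k) ⟩
    + suc n ℤ.* ⟦ suc n C k ⟧ ∎

bottom-step : ∀ k d → Proportional (+ suc k) (+ d) ⟦ k + d C suc k ⟧ ⟦ k + d C k ⟧
bottom-step k d =
  proportional (pos-*-cong (suc k) ((k + d) C suc k) d ((k + d) C k) ([1+k]*[k+d]C[1+k]≡d*[k+d]Ck k d))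

fromℚᵘ-homo-* : ∀ p q → fromℚᵘ (p ℚᵘ.* q) ≡ fromℚᵘ p ℚ.* fromℚᵘ q
fromℚᵘ-homo-* p q = ℚP.toℚᵘ-injective (ℚᵘP.≃-trans (ℚP.toℚᵘ-fromℚᵘ (p ℚᵘ.* q))
  (ℚᵘP.≃-sym (ℚᵘP.≃-trans (ℚP.toℚᵘ-homo-* (fromℚᵘ p) (fromℚᵘ q))
                          (ℚᵘP.*-cong (ℚP.toℚᵘ-fromℚᵘ p) (ℚP.toℚᵘ-fromℚᵘ q)))))

fromℚᵘ-homo-+ : ∀ p q → fromℚᵘ (p ℚᵘ.+ q) ≡ fromℚᵘ p ℚ.+ fromℚᵘ q
fromℚᵘ-homo-+ p q = ℚP.toℚᵘ-injective (ℚᵘP.≃-trans (ℚP.toℚᵘ-fromℚᵘ (p ℚᵘ.+ q))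
  (ℚᵘP.≃-sym (ℚᵘP.≃-trans (ℚP.toℚᵘ-homo-+ (fromℚᵘ p) (fromℚᵘ q))
                          (ℚᵘP.+-cong (ℚP.toℚᵘ-fromℚᵘ p) (ℚP.toℚᵘ-fromℚᵘ q)))))

frac-cong : ∀ p q p' q' .{{_ : ℕ.NonZero q}} .{{_ : ℕ.NonZero q'}} →
            p * q' ≡ p' * q → frac p q ≡ frac p' q'
frac-cong p (suc q) p' (suc q') eq =
  ℚP.fromℚᵘ-cong {mkℚᵘ (+ p) q} {mkℚᵘ (+ p') q'} (*≡* (pos-*-cong p (suc q') p' (suc q) eq))

frac-* : ∀ p q p' q' .{{_ : ℕ.NonZero q}} .{{_ : ℕ.NonZero q'}} →
         frac p q ℚ.* frac p' q' ≡ frac (p * p') (q * q')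
frac-* p (suc q) p' (suc q') = trans (sym (fromℚᵘ-homo-* (mkℚᵘ (+ p) q) (mkℚᵘ (+ p') q')))
  (ℚP.fromℚᵘ-cong {mkℚᵘ (+ p ℤ.* + p') (q' + q * suc q')} {mkℚᵘ (+ (p * p')) (q' + q * suc q')}
    (*≡* (cong (ℤ._* + (suc q * suc q')) (sym (ℤP.pos-* p p')))))

frac-+ : ∀ p q p' q' .{{_ : ℕ.NonZero q}} .{{_ : ℕ.NonZero q'}} →
         frac p q ℚ.+ frac p' q' ≡ frac (p * q' + p' * q) (q * q')
frac-+ p (suc q) p' (suc q') = trans (sym (fromℚᵘ-homo-+ (mkℚᵘ (+ p) q) (mkℚᵘ (+ p') q')))
  (ℚP.fromℚᵘ-cong {mkℚᵘ (+ p ℤ.* + suc q' ℤ.+ + p' ℤ.* + suc q) (q' + q * suc q')}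
                  {mkℚᵘ (+ (p * suc q' + p' * suc q)) (q' + q * suc q')}
    (*≡* (cong (ℤ._* + (suc q * suc q')) numerator)))
  where
  numerator : + p ℤ.* + suc q' ℤ.+ + p' ℤ.* + suc q ≡ + (p * suc q' + p' * suc q)
  numerator = sym (trans (ℤP.pos-+ (p * suc q') (p' * suc q))
                         (cong₂ ℤ._+_ (ℤP.pos-* p (suc q')) (ℤP.pos-* p' (suc q))))

if-×-dec : ∀ {P Q : Set} (p? : Dec P) (q? : Dec Q) {A B : ℚ} →
           (P → Q → A ≡ B) → (¬ P → 0ℚ ≡ B) → (¬ Q → 0ℚ ≡ B) →
           (if ⌊ p? ×-dec q? ⌋ then A else 0ℚ) ≡ B
if-×-dec (yes p) (yes q) both _    _     = both p q
if-×-dec (no ¬p) _       _    left _     = left ¬p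
if-×-dec (yes _) (no ¬q) _    _    right = right ¬q

-- The numerator of w_{n,K+1,m} when n = K + D + 2 (so D = n - (K+1) - 1),
-- read for every m ≥ 0: the binomials vanish where the paper's conditions fail.
w-numerator : ℕ → ℕ → ℕ → ℕ → ℕ
w-numerator n K D zero    = 0
w-numerator n K D (suc j) = (n C K) * (D C j) * (suc K C suc j)

w-numeratorℤ : ℕ → ℕ → ℕ → ℕ → ℤ
w-numeratorℤ n K D zero    = + 0
w-numeratorℤ n K D (suc j) = ⟦ n C K ⟧ ℤ.* ⟦ D C j ⟧ ℤ.* ⟦ suc K C suc j ⟧

pos-w-numerator : ∀ n K D m → + w-numerator n K D m ≡ w-numeratorℤ n K D m
pos-w-numerator n K D zero    = refl
pos-w-numerator n K D (suc j) =
  trans (ℤP.pos-* ((n C K) * (D C j)) (suc K C suc j))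
        (cong (ℤ._* ⟦ suc K C suc j ⟧) (ℤP.pos-* (n C K) (D C j)))

w-at : ∀ {n} K D → n ≡ suc K + suc D → ∀ m → w n (suc K) (+ m) ≡ frac (w-numerator n K D m) (suc K)
w-at K D refl zero with suc K + suc D ≟ suc K
... | yes eq = ⊥-elim (m+1+n≢m (suc K) eq)
... | no _   = sym (ℚP.0/n≡0 (suc K))
w-at K D refl (suc j) =
  if-×-dec (suc j ≤? suc K) (suc K + suc j ≤? n) (λ _ _ → fraction)
           (λ j≰K → vanishing (top-vanishes j≰K)) (λ ≰ → vanishing (middle-vanishes ≰))
  where
  n X X' : ℕ
  n  = suc K + suc D
  X  = (n C K) * ((n ∸ suc K ∸ 1) C j) * (suc K C suc j)
  X' = (n C K) * (D C j) * (suc K C suc j)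
  fraction : frac 1 (suc K) ℚ.* ℕtoℚ X ≡ frac X' (suc K)
  fraction = begin
    frac 1 (suc K) ℚ.* frac X 1  ≡⟨ frac-* 1 (suc K) X 1 ⟩
    frac (1 * X) (suc K * 1)     ≡⟨ cong₂ frac (trans (*-identityˡ X) X≡X') (*-identityʳ (suc K)) ⟩
    frac X' (suc K)              ∎
    where
    X≡X' : X ≡ X'
    X≡X' = cong (λ d → (n C K) * ((d ∸ 1) C j) * (suc K C suc j)) (m+n∸m≡n (suc K) (suc D))
  vanishing : X' ≡ 0 → 0ℚ ≡ frac X' (suc K)
  vanishing X'≡0 = sym (trans (cong (λ x → frac x (suc K)) X'≡0) (ℚP.0/n≡0 (suc K)))
  top-vanishes : ¬ suc j ≤ suc K → X' ≡ 0
  top-vanishes j≰K =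
    trans (cong ((n C K) * (D C j) *_) (k>n⇒nCk≡0 (≰⇒> j≰K))) (*-zeroʳ ((n C K) * (D C j)))
  middle-vanishes : ¬ suc K + suc j ≤ n → X' ≡ 0
  middle-vanishes ≰ = trans (cong (λ x → (n C K) * x * (suc K C suc j)) (k>n⇒nCk≡0 D<j))
                            (cong (_* (suc K C suc j)) (*-zeroʳ (n C K)))
    where
    D<j : D ℕ.< j
    D<j = ≤-pred (+-cancelˡ-< (suc K) (suc D) (suc j) (≰⇒> ≰))

recurrence-polynomial : ∀ K T J →
      (+ 1 ℤ.+ K) ℤ.* (+ 2 ℤ.+ K) ℤ.* (+ 2 ℤ.+ T)
        ℤ.* ((+ 1 ℤ.+ (K ℤ.+ T)) ℤ.- J) ℤ.* ((+ 2 ℤ.+ (K ℤ.+ T)) ℤ.- J)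
    ℤ.+ (+ 3 ℤ.+ (K ℤ.+ T)) ℤ.* (+ 2 ℤ.+ (K ℤ.+ T)) ℤ.* T
        ℤ.* ((+ 1 ℤ.+ K) ℤ.- (+ 1 ℤ.+ J)) ℤ.* ((+ 2 ℤ.+ K) ℤ.- (+ 1 ℤ.+ J))
  ≡   (+ 2 ℤ.+ T) ℤ.* (+ 1 ℤ.+ T) ℤ.* T ℤ.* J ℤ.* (+ 1 ℤ.+ J)
    ℤ.+ + 2 ℤ.* (+ 1 ℤ.+ K) ℤ.* (+ 2 ℤ.+ (K ℤ.+ T)) ℤ.* (+ 1 ℤ.+ T)
        ℤ.* ((+ 2 ℤ.+ (K ℤ.+ T)) ℤ.- J) ℤ.* ((+ 2 ℤ.+ K) ℤ.- (+ 1 ℤ.+ J))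
recurrence-polynomial = ℤ-Ring.solve-∀

RecurrenceAt : (n k k₁ k₂ : ℕ) → ℤ → Set
RecurrenceAt n k k₁ k₂ m =
  w n k₂ m ≡ (a n k ℚ.* w n k₁ (m ℤ.- + 1) ℚ.+ b n k ℚ.* w n k₁ m) ℚ.- c n k ℚ.* w n k m

zero-recurrence : ∀ {W₂ W₁⁻ W₁ W₀} A B C → W₂ ≡ 0ℚ → W₁⁻ ≡ 0ℚ → W₁ ≡ 0ℚ → W₀ ≡ 0ℚ →
                  W₂ ≡ (A ℚ.* W₁⁻ ℚ.+ B ℚ.* W₁) ℚ.- C ℚ.* W₀
zero-recurrence A B C refl refl refl refl
  rewrite ℚP.*-zeroʳ A | ℚP.*-zeroʳ B | ℚP.*-zeroʳ C = refl

-- The range 1 ≤ k, 2k + 3 ≤ n of the theorem, as k = κ + 1 and n = k + (3 + (k + t)).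
module Recurrence (κ t : ℕ) where
  k N n k₁ k₂ M N₁ N⁺ T₁ T₂ : ℕ
  k  = suc κ
  N  = 3 + (k + t)
  n  = k + N
  k₁ = suc k
  k₂ = suc (suc k)
  M  = suc (k + t)
  N₁ = 2 + (k + t)
  N⁺ = suc N
  T₁ = suc t
  T₂ = 2 + t

  n∸k : n ∸ k ≡ N
  n∸k = m+n∸m≡n k N

  n∸2k : n ∸ 2 * k ≡ 3 + t
  n∸2k = trans (cong (_∸ 2 * k) (split κ t)) (m+n∸m≡n (2 * k) (3 + t))
    where
    split : ∀ κ t → suc κ + (3 + (suc κ + t)) ≡ 2 * suc κ + (3 + t)
    split = ℕ-Ring.solve-∀

  aₙ a_d bₙ b_d cₙ c_d : ℕ
  aₙ  = N * T₁ * t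
  a_d = k₁ * k₂ * M
  bₙ  = 2 * N * N₁ * T₁
  b_d = k₂ * M * T₂
  cₙ  = N⁺ * N * N * t
  c_d = k₁ * k₂ * M * T₂

  a-at : a n k ≡ frac aₙ a_d
  a-at = begin
    a n k
      ≡⟨ cong₂ (λ d e → frac (d * (e ∸ 2) * (e ∸ 3)) ((k + 1) * (k + 2) * (d ∸ 2))) n∸k n∸2k ⟩
    frac aₙ ((k + 1) * (k + 2) * M)
      ≡⟨ cong₂ (λ p q → frac aₙ (p * q * M)) (+-comm k 1) (+-comm k 2) ⟩
    frac aₙ a_d ∎

  b-at : b n k ≡ frac bₙ b_d
  b-at = begin
    b n k
      ≡⟨ cong₂ (λ d e → frac (2 * d * (d ∸ 1) * (e ∸ 2)) ((k + 2) * (d ∸ 2) * (e ∸ 1))) n∸k n∸2k ⟩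
    frac bₙ ((k + 2) * M * T₂)
      ≡⟨ cong (λ q → frac bₙ (q * M * T₂)) (+-comm k 2) ⟩
    frac bₙ b_d ∎

  c-at : c n k ≡ frac cₙ c_d
  c-at = begin
    c n k
      ≡⟨ cong₂ (λ d e → frac ((d + 1) * d * d * (e ∸ 3)) ((k + 1) * (k + 2) * (d ∸ 2) * (e ∸ 1)))
               n∸k n∸2k ⟩
    frac ((N + 1) * N * N * t) ((k + 1) * (k + 2) * M * T₂)
      ≡⟨ cong₂ (λ r p → frac (r * N * N * t) (p * (k + 2) * M * T₂)) (+-comm N 1) (+-comm k 1) ⟩
    frac cₙ (k₁ * (k + 2) * M * T₂)
      ≡⟨ cong (λ q → frac cₙ (k₁ * q * M * T₂)) (+-comm k 2) ⟩
    frac cₙ c_d ∎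

  W₂-at : ∀ m → w n k₂ (+ m) ≡ frac (w-numerator n k₁ (k + t) m) k₂
  W₂-at = w-at k₁ (k + t) (shift κ t)
    where
    shift : ∀ κ t → suc κ + (3 + (suc κ + t)) ≡ suc (suc (suc κ)) + suc (suc κ + t)
    shift = ℕ-Ring.solve-∀

  W₁-at : ∀ m → w n k₁ (+ m) ≡ frac (w-numerator n k M m) k₁
  W₁-at = w-at k M (shift κ t)
    where
    shift : ∀ κ t → suc κ + (3 + (suc κ + t)) ≡ suc (suc κ) + suc (suc (suc κ + t))
    shift = ℕ-Ring.solve-∀

  W₀-at : ∀ m → w n k (+ m) ≡ frac (w-numerator n κ N₁ m) k
  W₀-at = w-at κ N₁ (shift κ t)
    where
    shift : ∀ κ t → suc κ + (3 + (suc κ + t)) ≡ suc κ + suc (2 + (suc κ + t))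
    shift = ℕ-Ring.solve-∀

  x₂ x₁⁻ x₁ x₀ : ℕ → ℕ
  x₂  j = w-numerator n k₁ (k + t) (suc j)
  x₁⁻ j = w-numerator n k M j
  x₁  j = w-numerator n k M (suc j)
  x₀  j = w-numerator n κ N₁ (suc j)

  X₂ X₁⁻ X₁ X₀ : ℕ → ℤ
  X₂  j = w-numeratorℤ n k₁ (k + t) (suc j)
  X₁⁻ j = w-numeratorℤ n k M j
  X₁  j = w-numeratorℤ n k M (suc j)
  X₀  j = w-numeratorℤ n κ N₁ (suc j)

  -- Multiplying the recurrence by k (k+1)² (k+2) (k+t+1) (t+2) gives
  -- P₂ x₂ + P₀ x₀ = P₁⁻ x₁⁻ + P₁ x₁.
  P₂ P₀ P₁⁻ P₁ : ℕ
  P₂  = k * k₁ * k₁ * M * T₂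
  P₀  = k₁ * N⁺ * N * N * t
  P₁⁻ = k * T₂ * N * T₁ * t
  P₁  = 2 * k * k₁ * N * N₁ * T₁

  recurrence-of-cleared : ∀ x₂ x₀ x₁⁻ x₁ → P₂ * x₂ + P₀ * x₀ ≡ P₁⁻ * x₁⁻ + P₁ * x₁ →
    frac x₂ k₂ ≡ (frac aₙ a_d ℚ.* frac x₁⁻ k₁ ℚ.+ frac bₙ b_d ℚ.* frac x₁ k₁)
                 ℚ.- frac cₙ c_d ℚ.* frac x₀ k
  recurrence-of-cleared x₂ x₀ x₁⁻ x₁ cleared =
    x≈z//y (frac x₂ k₂) (frac cₙ c_d ℚ.* frac x₀ k)
           (frac aₙ a_d ℚ.* frac x₁⁻ k₁ ℚ.+ frac bₙ b_d ℚ.* frac x₁ k₁) (begin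
      frac x₂ k₂ ℚ.+ frac cₙ c_d ℚ.* frac x₀ k
        ≡⟨ cong (frac x₂ k₂ ℚ.+_) (frac-* cₙ c_d x₀ k) ⟩
      frac x₂ k₂ ℚ.+ frac (cₙ * x₀) (c_d * k)
        ≡⟨ frac-+ x₂ k₂ (cₙ * x₀) (c_d * k) ⟩
      frac (x₂ * (c_d * k) + cₙ * x₀ * k₂) (k₂ * (c_d * k))
        ≡⟨ frac-cong (x₂ * (c_d * k) + cₙ * x₀ * k₂) (k₂ * (c_d * k))
                     (aₙ * x₁⁻ * (b_d * k₁) + bₙ * x₁ * (a_d * k₁)) ((a_d * k₁) * (b_d * k₁)) cross ⟩
      frac (aₙ * x₁⁻ * (b_d * k₁) + bₙ * x₁ * (a_d * k₁)) ((a_d * k₁) * (b_d * k₁))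
        ≡⟨ frac-+ (aₙ * x₁⁻) (a_d * k₁) (bₙ * x₁) (b_d * k₁) ⟨
      frac (aₙ * x₁⁻) (a_d * k₁) ℚ.+ frac (bₙ * x₁) (b_d * k₁)
        ≡⟨ cong₂ ℚ._+_ (frac-* aₙ a_d x₁⁻ k₁) (frac-* bₙ b_d x₁ k₁) ⟨
      frac aₙ a_d ℚ.* frac x₁⁻ k₁ ℚ.+ frac bₙ b_d ℚ.* frac x₁ k₁ ∎)
    where
    F : ℕ
    F = k₁ * k₁ * k₂ * k₂ * k₂ * M * M * T₂
    cross : (x₂ * (c_d * k) + cₙ * x₀ * k₂) * ((a_d * k₁) * (b_d * k₁))
          ≡ (aₙ * x₁⁻ * (b_d * k₁) + bₙ * x₁ * (a_d * k₁)) * (k₂ * (c_d * k))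
    cross = begin
      (x₂ * (c_d * k) + cₙ * x₀ * k₂) * ((a_d * k₁) * (b_d * k₁))
        ≡⟨ clearˡ k k₁ k₂ M N N⁺ t T₂ x₂ x₀ ⟩
      F * (P₂ * x₂ + P₀ * x₀)
        ≡⟨ cong (F *_) cleared ⟩
      F * (P₁⁻ * x₁⁻ + P₁ * x₁)
        ≡⟨ clearʳ k k₁ k₂ M N N₁ t T₁ T₂ x₁⁻ x₁ ⟩
      (aₙ * x₁⁻ * (b_d * k₁) + bₙ * x₁ * (a_d * k₁)) * (k₂ * (c_d * k)) ∎
      where
      clearˡ : ∀ k k₁ k₂ M N N⁺ t T₂ x₂ x₀ →
          (x₂ * (k₁ * k₂ * M * T₂ * k) + N⁺ * N * N * t * x₀ * k₂)
          * ((k₁ * k₂ * M * k₁) * (k₂ * M * T₂ * k₁))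
        ≡ (k₁ * k₁ * k₂ * k₂ * k₂ * M * M * T₂)
          * ((k * k₁ * k₁ * M * T₂) * x₂ + (k₁ * N⁺ * N * N * t) * x₀)
      clearˡ = ℕ-Ring.solve-∀
      clearʳ : ∀ k k₁ k₂ M N N₁ t T₁ T₂ x₁⁻ x₁ →
          (k₁ * k₁ * k₂ * k₂ * k₂ * M * M * T₂)
          * ((k * T₂ * N * T₁ * t) * x₁⁻ + (2 * k * k₁ * N * N₁ * T₁) * x₁)
        ≡ (N * T₁ * t * x₁⁻ * (k₂ * M * T₂ * k₁) + 2 * N * N₁ * T₁ * x₁ * (k₁ * k₂ * M * k₁))
          * (k₂ * (k₁ * k₂ * M * T₂ * k))
      clearʳ = ℕ-Ring.solve-∀

  B : ℕ → ℤ
  B j = ⟦ n C k ⟧ ℤ.* ⟦ N₁ C j ⟧ ℤ.* ⟦ k₂ C suc j ⟧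

  n-above : Proportional (+ k₁) (+ N) ⟦ n C k₁ ⟧ ⟦ n C k ⟧
  n-above = bottom-step k N

  n-below : Proportional (+ N⁺) (+ k) ⟦ n C κ ⟧ ⟦ n C k ⟧
  n-below = proportional (subst (λ m → + N⁺ ℤ.* ⟦ m C κ ⟧ ≡ + k ℤ.* ⟦ m C k ⟧) (+-suc κ N)
                                (sym (equation (bottom-step κ N⁺))))

  X₂-ratio : ∀ j → Proportional (+ k₁ ℤ.* (+ N₁ ℤ.* + M)) (+ N ℤ.* ((+ M ℤ.- + j) ℤ.* (+ N₁ ℤ.- + j)))
                                (X₂ j) (B j)
  X₂-ratio j = proportional-∙ʳ ⟦ k₂ C suc j ⟧
    (proportional-∙ n-above (proportional-trans (top-step (k + t) j) (top-step M j)))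

  X₁-ratio : ∀ j → Proportional (+ N₁ ℤ.* + k₂) ((+ N₁ ℤ.- + j) ℤ.* (+ k₂ ℤ.- + suc j))
                                (X₁ j) (B j)
  X₁-ratio j = proportional-∙ (proportional-∙ˡ ⟦ n C k ⟧ (top-step M j)) (top-step k₁ (suc j))

  X₁⁻-ratio : ∀ j → Proportional (+ N₁ ℤ.* + k₂) (+ j ℤ.* + suc j) (X₁⁻ j) (B j)
  X₁⁻-ratio zero    = proportional (ℤP.*-zeroʳ (+ N₁ ℤ.* + k₂))
  X₁⁻-ratio (suc j) = proportional-∙ (proportional-∙ˡ ⟦ n C k ⟧ (absorption M j)) (absorption k₁ (suc j))

  X₀-ratio : ∀ j → Proportional (+ N⁺ ℤ.* (+ k₂ ℤ.* + k₁))
                                (+ k ℤ.* ((+ k₁ ℤ.- + suc j) ℤ.* (+ k₂ ℤ.- + suc j)))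
                                (X₀ j) (B j)
  X₀-ratio j = proportional-∙ (proportional-∙ʳ ⟦ N₁ C j ⟧ n-below)
    (proportional-trans (top-step k (suc j)) (top-step k₁ (suc j)))

  P₂ℤ P₀ℤ P₁⁻ℤ P₁ℤ Λ Φ : ℤ
  P₂ℤ  = + k ℤ.* + k₁ ℤ.* + k₁ ℤ.* + M ℤ.* + T₂
  P₀ℤ  = + k₁ ℤ.* + N⁺ ℤ.* + N ℤ.* + N ℤ.* + t
  P₁⁻ℤ = + k ℤ.* + T₂ ℤ.* + N ℤ.* + T₁ ℤ.* + t
  P₁ℤ  = + 2 ℤ.* + k ℤ.* + k₁ ℤ.* + N ℤ.* + N₁ ℤ.* + T₁
  Λ    = + k₁ ℤ.* + k₂ ℤ.* + N₁ ℤ.* + M ℤ.* + N⁺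
  Φ    = + k ℤ.* + N ℤ.* + N⁺ ℤ.* + k₁ ℤ.* + M

  -- Λ clears the denominators of the four proportions: Λ · Pᵢ · Xᵢ = Φ · rᵢ · B, where
  -- the rᵢ are the summands of recurrence-polynomial.
  module _ (j : ℕ) where
    J J₁ r₂ r₀ r₁⁻ r₁ : ℤ
    J   = + j
    J₁  = + suc j
    r₂  = + k₁ ℤ.* + k₂ ℤ.* + T₂ ℤ.* (+ M ℤ.- J) ℤ.* (+ N₁ ℤ.- J)
    r₀  = + N ℤ.* + N₁ ℤ.* + t ℤ.* (+ k₁ ℤ.- J₁) ℤ.* (+ k₂ ℤ.- J₁)
    r₁⁻ = + T₂ ℤ.* + T₁ ℤ.* + t ℤ.* J ℤ.* J₁
    r₁  = + 2 ℤ.* + k₁ ℤ.* + N₁ ℤ.* + T₁ ℤ.* (+ N₁ ℤ.- J) ℤ.* (+ k₂ ℤ.- J₁)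

    X₂-term : (Λ ℤ.* P₂ℤ) ℤ.* X₂ j ≡ (Φ ℤ.* r₂) ℤ.* B j
    X₂-term = proportional-rescale (X₂-ratio j)
      (proportional (monomial (+ k) (+ k₁) (+ k₂) (+ N) (+ N₁) (+ M) (+ N⁺) (+ T₂) (+ M ℤ.- J) (+ N₁ ℤ.- J)))
      where
      monomial : ∀ K k₁ k₂ N N₁ M N⁺ T₂ d₂ d₁ →
        (N ℤ.* (d₂ ℤ.* d₁)) ℤ.* ((k₁ ℤ.* k₂ ℤ.* N₁ ℤ.* M ℤ.* N⁺) ℤ.* (K ℤ.* k₁ ℤ.* k₁ ℤ.* M ℤ.* T₂))
        ≡ (k₁ ℤ.* (N₁ ℤ.* M)) ℤ.* ((K ℤ.* N ℤ.* N⁺ ℤ.* k₁ ℤ.* M) ℤ.* (k₁ ℤ.* k₂ ℤ.* T₂ ℤ.* d₂ ℤ.* d₁))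
      monomial = ℤ-Ring.solve-∀

    X₀-term : (Λ ℤ.* P₀ℤ) ℤ.* X₀ j ≡ (Φ ℤ.* r₀) ℤ.* B j
    X₀-term = proportional-rescale (X₀-ratio j)
      (proportional (monomial (+ k) (+ k₁) (+ k₂) (+ N) (+ N₁) (+ M) (+ N⁺) (+ t) (+ k₁ ℤ.- J₁) (+ k₂ ℤ.- J₁)))
      where
      monomial : ∀ K k₁ k₂ N N₁ M N⁺ T e₀ e₁ →
        (K ℤ.* (e₀ ℤ.* e₁)) ℤ.* ((k₁ ℤ.* k₂ ℤ.* N₁ ℤ.* M ℤ.* N⁺) ℤ.* (k₁ ℤ.* N⁺ ℤ.* N ℤ.* N ℤ.* T))
        ≡ (N⁺ ℤ.* (k₂ ℤ.* k₁)) ℤ.* ((K ℤ.* N ℤ.* N⁺ ℤ.* k₁ ℤ.* M) ℤ.* (N ℤ.* N₁ ℤ.* T ℤ.* e₀ ℤ.* e₁))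
      monomial = ℤ-Ring.solve-∀

    X₁⁻-term : (Λ ℤ.* P₁⁻ℤ) ℤ.* X₁⁻ j ≡ (Φ ℤ.* r₁⁻) ℤ.* B j
    X₁⁻-term = proportional-rescale (X₁⁻-ratio j)
      (proportional (monomial (+ k) (+ k₁) (+ k₂) (+ N) (+ N₁) (+ M) (+ N⁺) (+ t) (+ T₁) (+ T₂) J J₁))
      where
      monomial : ∀ K k₁ k₂ N N₁ M N⁺ T T₁ T₂ J J₁ →
        (J ℤ.* J₁) ℤ.* ((k₁ ℤ.* k₂ ℤ.* N₁ ℤ.* M ℤ.* N⁺) ℤ.* (K ℤ.* T₂ ℤ.* N ℤ.* T₁ ℤ.* T))
        ≡ (N₁ ℤ.* k₂) ℤ.* ((K ℤ.* N ℤ.* N⁺ ℤ.* k₁ ℤ.* M) ℤ.* (T₂ ℤ.* T₁ ℤ.* T ℤ.* J ℤ.* J₁))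
      monomial = ℤ-Ring.solve-∀

    X₁-term : (Λ ℤ.* P₁ℤ) ℤ.* X₁ j ≡ (Φ ℤ.* r₁) ℤ.* B j
    X₁-term = proportional-rescale (X₁-ratio j)
      (proportional (monomial (+ k) (+ k₁) (+ k₂) (+ N) (+ N₁) (+ M) (+ N⁺) (+ T₁) (+ N₁ ℤ.- J) (+ k₂ ℤ.- J₁)))
      where
      monomial : ∀ K k₁ k₂ N N₁ M N⁺ T₁ d₁ e₁ →
        (d₁ ℤ.* e₁) ℤ.* ((k₁ ℤ.* k₂ ℤ.* N₁ ℤ.* M ℤ.* N⁺) ℤ.* (+ 2 ℤ.* K ℤ.* k₁ ℤ.* N ℤ.* N₁ ℤ.* T₁))
        ≡ (N₁ ℤ.* k₂) ℤ.* ((K ℤ.* N ℤ.* N⁺ ℤ.* k₁ ℤ.* M) ℤ.* (+ 2 ℤ.* k₁ ℤ.* N₁ ℤ.* T₁ ℤ.* d₁ ℤ.* e₁))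
      monomial = ℤ-Ring.solve-∀

  clearedℤ : ∀ j → P₂ℤ ℤ.* X₂ j ℤ.+ P₀ℤ ℤ.* X₀ j ≡ P₁⁻ℤ ℤ.* X₁⁻ j ℤ.+ P₁ℤ ℤ.* X₁ j
  clearedℤ j = ℤP.*-cancelˡ-≡ Λ _ _ (begin
    Λ ℤ.* (P₂ℤ ℤ.* X₂ j ℤ.+ P₀ℤ ℤ.* X₀ j)             ≡⟨ distribute Λ P₂ℤ (X₂ j) P₀ℤ (X₀ j) ⟩
    (Λ ℤ.* P₂ℤ) ℤ.* X₂ j ℤ.+ (Λ ℤ.* P₀ℤ) ℤ.* X₀ j     ≡⟨ cong₂ ℤ._+_ (X₂-term j) (X₀-term j) ⟩
    (Φ ℤ.* r₂ j) ℤ.* B j ℤ.+ (Φ ℤ.* r₀ j) ℤ.* B j     ≡⟨ collect Φ (r₂ j) (r₀ j) (B j) ⟩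
    Φ ℤ.* ((r₂ j ℤ.+ r₀ j) ℤ.* B j)                  ≡⟨ cong (λ r → Φ ℤ.* (r ℤ.* B j))
                                                            (recurrence-polynomial (+ k) (+ t) (+ j)) ⟩
    Φ ℤ.* ((r₁⁻ j ℤ.+ r₁ j) ℤ.* B j)                 ≡⟨ collect Φ (r₁⁻ j) (r₁ j) (B j) ⟨
    (Φ ℤ.* r₁⁻ j) ℤ.* B j ℤ.+ (Φ ℤ.* r₁ j) ℤ.* B j    ≡⟨ cong₂ ℤ._+_ (X₁⁻-term j) (X₁-term j) ⟨
    (Λ ℤ.* P₁⁻ℤ) ℤ.* X₁⁻ j ℤ.+ (Λ ℤ.* P₁ℤ) ℤ.* X₁ j   ≡⟨ distribute Λ P₁⁻ℤ (X₁⁻ j) P₁ℤ (X₁ j) ⟨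
    Λ ℤ.* (P₁⁻ℤ ℤ.* X₁⁻ j ℤ.+ P₁ℤ ℤ.* X₁ j)          ∎)
    where
    distribute : ∀ a b x c y → a ℤ.* (b ℤ.* x ℤ.+ c ℤ.* y) ≡ (a ℤ.* b) ℤ.* x ℤ.+ (a ℤ.* c) ℤ.* y
    distribute = ℤ-Ring.solve-∀
    collect : ∀ f r s b → (f ℤ.* r) ℤ.* b ℤ.+ (f ℤ.* s) ℤ.* b ≡ f ℤ.* ((r ℤ.+ s) ℤ.* b)
    collect = ℤ-Ring.solve-∀

  cleared : ∀ j → P₂ * x₂ j + P₀ * x₀ j ≡ P₁⁻ * x₁⁻ j + P₁ * x₁ j
  cleared j = ℤP.+-injective (begin
    + (P₂ * x₂ j + P₀ * x₀ j)                ≡⟨ pos-sum P₂ (x₂ j) P₀ (x₀ j) ⟩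
    + P₂ ℤ.* + x₂ j ℤ.+ + P₀ ℤ.* + x₀ j        ≡⟨ cong₂ ℤ._+_ (cong (P₂ℤ ℤ.*_) (pos-w-numerator n k₁ (k + t) (suc j)))
                                                           (cong₂ ℤ._*_ P₀-cast (pos-w-numerator n κ N₁ (suc j))) ⟩
    P₂ℤ ℤ.* X₂ j ℤ.+ P₀ℤ ℤ.* X₀ j              ≡⟨ clearedℤ j ⟩
    P₁⁻ℤ ℤ.* X₁⁻ j ℤ.+ P₁ℤ ℤ.* X₁ j            ≡⟨ cong₂ ℤ._+_ (cong₂ ℤ._*_ P₁⁻-cast (pos-w-numerator n k M j))
                                                           (cong (P₁ℤ ℤ.*_) (pos-w-numerator n k M (suc j))) ⟨
    + P₁⁻ ℤ.* + x₁⁻ j ℤ.+ + P₁ ℤ.* + x₁ j      ≡⟨ pos-sum P₁⁻ (x₁⁻ j) P₁ (x₁ j) ⟨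
    + (P₁⁻ * x₁⁻ j + P₁ * x₁ j)              ∎)
    where
    pos-sum : ∀ p x q y → + (p * x + q * y) ≡ + p ℤ.* + x ℤ.+ + q ℤ.* + y
    pos-sum p x q y = trans (ℤP.pos-+ (p * x) (q * y)) (cong₂ ℤ._+_ (ℤP.pos-* p x) (ℤP.pos-* q y))
    P₀-cast : + P₀ ≡ P₀ℤ
    P₀-cast = ℤP.pos-* (k₁ * N⁺ * N * N) t
    P₁⁻-cast : + P₁⁻ ≡ P₁⁻ℤ
    P₁⁻-cast = ℤP.pos-* (k * T₂ * N * T₁) t

  recurrence : ∀ m → RecurrenceAt n k (k + 1) (k + 2) m
  recurrence m = subst₂ (λ k₁ k₂ → RecurrenceAt n k k₁ k₂ m) (+-comm 1 k) (+-comm 2 k) (recurrence-at m)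
    where
    recurrence-at : ∀ m → RecurrenceAt n k k₁ k₂ m
    recurrence-at -[1+ _ ] = zero-recurrence (a n k) (b n k) (c n k) refl refl refl refl
    recurrence-at (+ zero) = zero-recurrence (a n k) (b n k) (c n k)
      (vanishes k₁ (W₂-at 0)) refl (vanishes k (W₁-at 0)) (vanishes κ (W₀-at 0))
      where
      vanishes : ∀ {W} d → W ≡ frac 0 (suc d) → W ≡ 0ℚ
      vanishes d eq = trans eq (ℚP.0/n≡0 (suc d))
    recurrence-at (+ suc j) = begin
      w n k₂ (+ suc j)
        ≡⟨ W₂-at (suc j) ⟩
      frac (x₂ j) k₂
        ≡⟨ recurrence-of-cleared (x₂ j) (x₀ j) (x₁⁻ j) (x₁ j) (cleared j) ⟩
      (frac aₙ a_d ℚ.* frac (x₁⁻ j) k₁ ℚ.+ frac bₙ b_d ℚ.* frac (x₁ j) k₁) ℚ.- frac cₙ c_d ℚ.* frac (x₀ j) k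
        ≡⟨ cong₂ ℚ._-_ (cong₂ ℚ._+_ (cong₂ ℚ._*_ a-at (W₁-at j)) (cong₂ ℚ._*_ b-at (W₁-at (suc j))))
                       (cong₂ ℚ._*_ c-at (W₀-at (suc j))) ⟨
      (a n k ℚ.* w n k₁ (+ j) ℚ.+ b n k ℚ.* w n k₁ (+ suc j)) ℚ.- c n k ℚ.* w n k (+ suc j) ∎

2k+3≤n : ∀ n k → 1 ≤ k → k ≤ ⌊ n + 1 /2⌋ ∸ 2 → k + (3 + k) ≤ n
2k+3≤n n k 1≤k k≤h∸2 = ≤-pred (subst₂ _≤_ (double k) (trans (⌊n/2⌋+⌈n/2⌉≡n (n + 1)) (+-comm n 1))
                                 (+-mono-≤ k+2≤h (≤-trans k+2≤h (⌊n/2⌋≤⌈n/2⌉ (n + 1)))))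
  where
  1≤h∸2⇒2≤h : ∀ h → 1 ≤ h ∸ 2 → 2 ≤ h
  1≤h∸2⇒2≤h zero          ()
  1≤h∸2⇒2≤h (suc zero)    ()
  1≤h∸2⇒2≤h (suc (suc h)) _ = s≤s (s≤s z≤n)
  k+2≤h : k + 2 ≤ ⌊ n + 1 /2⌋
  k+2≤h = m≤o∸n⇒m+n≤o k (1≤h∸2⇒2≤h ⌊ n + 1 /2⌋ (≤-trans 1≤k k≤h∸2)) k≤h∸2
  double : ∀ k → k + 2 + (k + 2) ≡ suc (k + (3 + k))
  double = ℕ-Ring.solve-∀

lemma2p5 : (n k : ℕ) → 1 ≤ n → 1 ≤ k → k ≤ ⌊ n ℕ.+ 1 /2⌋ ∸ 2 →
    (m : ℤ) →
      w n (k ℕ.+ 2) m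
        ≡ (a n k ℚ.* w n (k ℕ.+ 1) (m ℤ.- ℤ.+ 1)
           ℚ.+ b n k ℚ.* w n (k ℕ.+ 1) m)
          ℚ.- c n k ℚ.* w n k m
lemma2p5 n zero _ () _ _
lemma2p5 n (suc κ) _ 1≤k k≤h∸2 m with m≤n⇒∃[o]m+o≡n (2k+3≤n n (suc κ) 1≤k k≤h∸2)
... | t , 2k+3+t≡n = subst (λ n → RecurrenceAt n (suc κ) (suc κ + 1) (suc κ + 2) m)
                           (trans (rearrange κ t) 2k+3+t≡n) (Recurrence.recurrence κ t m)
  where
  rearrange : ∀ κ t → suc κ + (3 + (suc κ + t)) ≡ suc κ + (3 + suc κ) + t
  rearrange = ℕ-Ring.solve-∀
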